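{- Let $X\subseteq B^h$, $G=Q_h(X)$, and let $u\in V(G)$ have degree $h$. Let $X'=\{x\in\widehat X: u\in I_G(0^h,x)\}$ (so that $G^u=G[\bigcup_{x\in X'}I_G(0^h,x)]$). Then $\left|\bigcup_{x\in X'}S^x\right|=h$.
   Context: $B=\{0,1\}$, $B^h$ binary words of length $h$, $Q_h$ the hypercube on $B^h$ (adjacent iff Hamming distance $1$). For $x\in B^h$, $S^x=\{i\in\{1,\dots,h\}: x_i=1\}$. $u\le v$ means $u_i\le v_i$ for all $i$. For $X\subseteq B^h$, $\widehat X$ is the set of maximal elements of $(X,\le)$ and the daisy cube $Q_h(X)$ is the subgraph of $Q_h$ induced by $\{v: v\le x\text{ for some }x\in X\}$. $I_G(a,b)$ is the set of vertices on shortest $a,b$-paths in $G$. -}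

module Defs where

open import Data.Nat using (ℕ; zero; suc; _+_; _≤_)
open import Data.Nat.Properties using (_≟_)
open import Data.Bool using (Bool; true; false)
import Data.Bool as B
import Data.Bool.Properties as BP
open import Data.Vec using (Vec; []; _∷_; replicate; lookup)
open import Data.Fin using (Fin)
open import Data.List using (List; []; _∷_; _++_; map; filter; length)
open import Data.List.Membership.Propositional using (_∈_)
open import Data.List.Relation.Unary.Any using (Any; any?)
open import Data.Vec.Relation.Binary.Pointwise.Inductive using (Pointwise; decidable)
open import Data.Product using (Σ; ∃; _×_; _,_)
open import Relation.Nullary using (Dec)
open import Relation.Nullary.Decidable using (_×-dec_)
open import Relation.Binary.PropositionalEquality using (_≡_)

Word : ℕ → Set
Word h = Vec Bool h

allWords : (h : ℕ) → List (Word h)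
allWords zero    = [] ∷ []
allWords (suc h) = map (false ∷_) (allWords h) ++ map (true ∷_) (allWords h)

zeroW : (h : ℕ) → Word h
zeroW h = replicate h false

_≤w_ : ∀ {h} → Word h → Word h → Set
u ≤w v = Pointwise B._≤_ u v

_≤w?_ : ∀ {h} (u v : Word h) → Dec (u ≤w v)
u ≤w? v = decidable BP._≤?_ u v

hamming : ∀ {h} → Word h → Word h → ℕ
hamming []       []       = 0
hamming (a ∷ u) (b ∷ v) with a B.≟ b
... | Relation.Nullary.yes _ = hamming u v
... | Relation.Nullary.no  _ = suc (hamming u v)

Adj : ∀ {h} → Word h → Word h → Set
Adj u v = hamming u v ≡ 1

Adj? : ∀ {h} (u v : Word h) → Dec (Adj u v)
Adj? u v = hamming u v ≟ 1

-- vertex set of the daisy cube Q_h(X):  v ≤ x for some x ∈ X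
InG : ∀ {h} → List (Word h) → Word h → Set
InG X v = Any (λ x → v ≤w x) X

InG? : ∀ {h} (X : List (Word h)) (v : Word h) → Dec (InG X v)
InG? X v = any? (λ x → v ≤w? x) X

degree : ∀ {h} → List (Word h) → Word h → ℕ
degree {h} X u = length (filter (λ v → InG? X v ×-dec Adj? u v) (allWords h))

data Walk {h} (X : List (Word h)) : Word h → Word h → ℕ → Set where
  nil  : ∀ {a} → InG X a → Walk X a a 0
  cons : ∀ {a c b n} → InG X a → Adj a c → Walk X c b n → Walk X a b (suc n)

-- u ∈ I_G(a,b): u lies on some shortest a,b-path in G
InInterval : ∀ {h} → List (Word h) → Word h → Word h → Word h → Set
InInterval X a b u =
  Σ ℕ λ k → Σ ℕ λ l → Walk X a u k × Walk X u b l × (∀ m → Walk X a b m → k + l ≤ m)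

Maximal : ∀ {h} → List (Word h) → Word h → Set
Maximal X x = x ∈ X × (∀ y → y ∈ X → x ≤w y → y ≡ x)

InSupport : ∀ {h} → Fin h → Word h → Set
InSupport i x = lookup x i ≡ true

-- If uᵢ = 1, any maximal x ≥ u has xᵢ = 1.  If uᵢ = 0, switching coordinate i on
-- gives a cube neighbour of u, and since u has degree h all h cube neighbours lie
-- in G; a maximal x above that neighbour has xᵢ = 1 and x ≥ u.  In either case
-- u ∈ I_G(0ʰ, x): everything below x lies in G, so there are monotone walks
-- 0ʰ → u → x, and their total length is the Hamming distance from 0ʰ to x, which
-- bounds the length of every walk.
module Submission where

open import Defs
open import Data.Bool using (true; false; not; if_then_else_; b≤b; f≤t)
import Data.Bool.Properties as Bool
open import Data.Fin using (Fin)
import Data.Fin as Fin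
open import Data.List using (List; []; _∷_; _++_; map; filter; length; allFin; tabulate)
open import Data.List.Properties
  using (filter-++; length-++; filter-complete; filter-none; length-tabulate; map-tabulate)
open import Data.List.Relation.Unary.All as All using (All)
open import Data.List.Relation.Unary.All.Properties using (all-filter)
open import Data.List.Relation.Unary.Any using (Any)
open import Data.List.Membership.Propositional using (_∈_; find; lose)
open import Data.List.Membership.Propositional.Properties using (∈-filter⁺; ∈-filter⁻; ∈-allFin)
open import Data.List.Extrema.Nat using (argmax; argmax-all; f[xs]≤f[argmax])
open import Data.Nat using (ℕ; suc; _+_; _≤_; z≤n; s≤s)
open import Data.Nat.Properties
  using (≤-reflexive; ≤-trans; n≤1+n; +-mono-≤; +-suc; +-comm; +-identityʳ; <⇒≱; _≟_; module ≤-Reasoning)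
open import Data.Empty using (⊥-elim)
open import Data.Product using (Σ; ∃; _×_; _,_; proj₁; proj₂)
open import Data.Vec using ([]; _∷_; lookup; updateAt)
open import Data.Vec.Properties using (lookup∘updateAt)
open import Data.Vec.Relation.Binary.Pointwise.Inductive as Pointwise using ([]; _∷_)
open import Function using (_∘_; id)
open import Level using (Level)
open import Relation.Nullary using (Dec; does)
open import Relation.Nullary.Decidable using (_×-dec_)
open import Relation.Unary using (Pred; Decidable)
open import Relation.Binary.PropositionalEquality
  using (_≡_; refl; sym; trans; cong; cong₂; subst; module ≡-Reasoning)

private
  variable
    ℓ : Level
    h : ℕ

hamming-refl : (a : Word h) → hamming a a ≡ 0
hamming-refl []          = refl
hamming-refl (false ∷ a) = hamming-refl a
hamming-refl (true ∷ a)  = hamming-refl a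

hamming-triangle : (a b c : Word h) → hamming a c ≤ hamming a b + hamming b c
hamming-triangle [] [] [] = z≤n
hamming-triangle (false ∷ a) (false ∷ b) (false ∷ c) = hamming-triangle a b c
hamming-triangle (true  ∷ a) (true  ∷ b) (true  ∷ c) = hamming-triangle a b c
hamming-triangle (false ∷ a) (true  ∷ b) (true  ∷ c) = s≤s (hamming-triangle a b c)
hamming-triangle (true  ∷ a) (false ∷ b) (false ∷ c) = s≤s (hamming-triangle a b c)
hamming-triangle (false ∷ a) (false ∷ b) (true  ∷ c) =
  subst (suc (hamming a c) ≤_) (sym (+-suc (hamming a b) (hamming b c)))
    (s≤s (hamming-triangle a b c))
hamming-triangle (true  ∷ a) (true  ∷ b) (false ∷ c) =
  subst (suc (hamming a c) ≤_) (sym (+-suc (hamming a b) (hamming b c)))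
    (s≤s (hamming-triangle a b c))
hamming-triangle (false ∷ a) (true  ∷ b) (false ∷ c) =
  ≤-trans (hamming-triangle a b c) (+-mono-≤ (n≤1+n _) (n≤1+n _))
hamming-triangle (true  ∷ a) (false ∷ b) (true  ∷ c) =
  ≤-trans (hamming-triangle a b c) (+-mono-≤ (n≤1+n _) (n≤1+n _))

hamming-≤-walk : ∀ {X : List (Word h)} {a b m} → Walk X a b m → hamming a b ≤ m
hamming-≤-walk {a = a} (nil _) = ≤-reflexive (hamming-refl a)
hamming-≤-walk {a = a} {b} (cons {c = c} {n = n} _ a~c c⇝b) = begin
  hamming a b               ≤⟨ hamming-triangle a c b ⟩
  hamming a c + hamming c b ≡⟨ cong (_+ hamming c b) a~c ⟩
  suc (hamming c b)         ≤⟨ s≤s (hamming-≤-walk c⇝b) ⟩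
  suc n                     ∎
  where open ≤-Reasoning

hamming-chain : ∀ {a b c : Word h} → a ≤w b → b ≤w c → hamming a b + hamming b c ≡ hamming a c
hamming-chain []                [] = refl
hamming-chain (b≤b {false} ∷ p) (b≤b ∷ q) = hamming-chain p q
hamming-chain (b≤b {true}  ∷ p) (b≤b ∷ q) = hamming-chain p q
hamming-chain (b≤b ∷ p)         (f≤t ∷ q) = trans (+-suc _ _) (cong suc (hamming-chain p q))
hamming-chain (f≤t ∷ p)         (b≤b ∷ q) = cong suc (hamming-chain p q)

≤w-refl : {a : Word h} → a ≤w a
≤w-refl = Pointwise.refl Bool.≤-refl

≤w-trans : {a b c : Word h} → a ≤w b → b ≤w c → a ≤w c
≤w-trans = Pointwise.trans Bool.≤-trans

zeroW-≤w : (a : Word h) → zeroW h ≤w a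
zeroW-≤w []      = []
zeroW-≤w (x ∷ a) = Bool.≤-minimum x ∷ zeroW-≤w a

-- Stated through an adjacency-preserving embedding f so that the recursion may
-- freeze the first coordinate and climb in the remaining ones.
ascending-walk-via : ∀ {k} {X : List (Word h)} (f : Word k → Word h) →
  (∀ {z z′} → Adj z z′ → Adj (f z) (f z′)) →
  ∀ {a b} → (∀ {z} → z ≤w b → InG X (f z)) → a ≤w b → Walk X (f a) (f b) (hamming a b)
ascending-walk-via f f-adj below [] = nil (below [])
ascending-walk-via f f-adj below (b≤b {false} ∷ a≤b) =
  ascending-walk-via (f ∘ (false ∷_)) (λ {z} {z′} → f-adj {false ∷ z} {false ∷ z′})
    (below ∘ (b≤b ∷_)) a≤b
ascending-walk-via f f-adj below (b≤b {true} ∷ a≤b) =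
  ascending-walk-via (f ∘ (true ∷_)) (λ {z} {z′} → f-adj {true ∷ z} {true ∷ z′})
    (below ∘ (b≤b ∷_)) a≤b
ascending-walk-via f f-adj {a = _ ∷ a} below (f≤t ∷ a≤b) =
  cons (below (f≤t ∷ a≤b)) (f-adj {false ∷ a} {true ∷ a} (cong suc (hamming-refl a)))
    (ascending-walk-via (f ∘ (true ∷_)) (λ {z} {z′} → f-adj {true ∷ z} {true ∷ z′})
      (below ∘ (b≤b ∷_)) a≤b)

ascending-walk : ∀ {X : List (Word h)} {a b} →
  (∀ {z} → z ≤w b → InG X z) → a ≤w b → Walk X a b (hamming a b)
ascending-walk = ascending-walk-via id id

≤w-interval : ∀ {X : List (Word h)} {a u x} → x ∈ X → a ≤w u → u ≤w x → InInterval X a x u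
≤w-interval {X = X} {a} {u} {x} x∈X a≤u u≤x =
  hamming a u , hamming u x ,
  ascending-walk (below ∘ (λ z≤u → ≤w-trans z≤u u≤x)) a≤u ,
  ascending-walk below u≤x ,
  λ m a⇝x → subst (_≤ m) (sym (hamming-chain a≤u u≤x)) (hamming-≤-walk a⇝x)
  where
    below : ∀ {z} → z ≤w x → InG X z
    below = lose x∈X

module _ {A : Set} {_≼_ : A → A → Set} (_≼?_ : ∀ x y → Dec (x ≼ y))
         (≼-trans : ∀ {x y z} → x ≼ y → y ≼ z → x ≼ z)
         (size : A → ℕ) (≼-size-≡ : ∀ {x z} → x ≼ z → size z ≤ size x → z ≡ x) where

  -- An element of maximum size among those above y is maximal.
  maximal-above : ∀ {y xs} → Any (y ≼_) xs →
    ∃ λ x → (x ∈ xs × (∀ z → z ∈ xs → x ≼ z → z ≡ x)) × y ≼ x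
  maximal-above {y} {xs} y≼xs = x , (proj₁ x-above , maximal) , proj₂ x-above
    where
      above : List A
      above = filter (y ≼?_) xs

      x : A
      x = argmax size (proj₁ (find y≼xs)) above

      x-above : x ∈ xs × y ≼ x
      x-above = argmax-all size (proj₂ (find y≼xs)) (All.tabulate (∈-filter⁻ (y ≼?_)))

      maximal : ∀ z → z ∈ xs → x ≼ z → z ≡ x
      maximal z z∈xs x≼z = ≼-size-≡ x≼z (All.lookup (f[xs]≤f[argmax] {f = size} _ above)
        (∈-filter⁺ (y ≼?_) z∈xs (≼-trans (proj₂ x-above) x≼z)))

weight : Word h → ℕ
weight []          = 0
weight (false ∷ x) = weight x
weight (true ∷ x)  = suc (weight x)

weight-mono : ∀ {x z : Word h} → x ≤w z → weight x ≤ weight z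
weight-mono []                = z≤n
weight-mono (b≤b {false} ∷ p) = weight-mono p
weight-mono (b≤b {true}  ∷ p) = s≤s (weight-mono p)
weight-mono (f≤t ∷ p)         = ≤-trans (weight-mono p) (n≤1+n _)

≤w-weight-≡ : ∀ {x z : Word h} → x ≤w z → weight z ≤ weight x → z ≡ x
≤w-weight-≡ []                _       = refl
≤w-weight-≡ (b≤b {false} ∷ p) w       = cong (false ∷_) (≤w-weight-≡ p w)
≤w-weight-≡ (b≤b {true}  ∷ p) (s≤s w) = cong (true ∷_) (≤w-weight-≡ p w)
≤w-weight-≡ (f≤t ∷ p)         w       = ⊥-elim (<⇒≱ w (weight-mono p))

InG⇒≤w-maximal : ∀ {X : List (Word h)} {y} → InG X y → ∃ λ x → Maximal X x × y ≤w x
InG⇒≤w-maximal = maximal-above _≤w?_ ≤w-trans weight ≤w-weight-≡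

module _ {A : Set} {P : Pred A ℓ} (P? : Decidable P) where

  length-filter-∷ : ∀ x xs →
    length (filter P? (x ∷ xs)) ≡ (if does (P? x) then 1 else 0) + length (filter P? xs)
  length-filter-∷ x xs with does (P? x)
  ... | true  = refl
  ... | false = refl

  length-filter-map : ∀ {B : Set} (f : B → A) xs →
    length (filter P? (map f xs)) ≡ length (filter (P? ∘ f) xs)
  length-filter-map f []       = refl
  length-filter-map f (x ∷ xs) with does (P? (f x))
  ... | true  = cong suc (length-filter-map f xs)
  ... | false = length-filter-map f xs

  length-filter-++ : ∀ xs ys →
    length (filter P? (xs ++ ys)) ≡ length (filter P? xs) + length (filter P? ys)
  length-filter-++ xs ys = trans (cong length (filter-++ P? xs ys)) (length-++ (filter P? xs))

module _ {P : Pred (Word (suc h)) ℓ} (P? : Decidable P) where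

  length-filter-allWords : length (filter P? (allWords (suc h))) ≡
    length (filter (P? ∘ (false ∷_)) (allWords h)) + length (filter (P? ∘ (true ∷_)) (allWords h))
  length-filter-allWords = trans (length-filter-++ P? (map (false ∷_) (allWords h)) _)
    (cong₂ _+_ (length-filter-map P? (false ∷_) (allWords h))
               (length-filter-map P? (true ∷_) (allWords h)))

module _ {P : Pred (Fin (suc h)) ℓ} (P? : Decidable P) where

  length-filter-allFin : length (filter P? (allFin (suc h))) ≡
    (if does (P? Fin.zero) then 1 else 0) + length (filter (P? ∘ Fin.suc) (allFin h))
  length-filter-allFin = begin
    length (filter P? (Fin.zero ∷ tabulate Fin.suc))
      ≡⟨ length-filter-∷ P? Fin.zero _ ⟩
    at-zero + length (filter P? (tabulate Fin.suc))
      ≡⟨ cong ((at-zero +_) ∘ length ∘ filter P?) (sym (map-tabulate id Fin.suc)) ⟩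
    at-zero + length (filter P? (map Fin.suc (allFin h)))
      ≡⟨ cong (at-zero +_) (length-filter-map P? Fin.suc (allFin h)) ⟩
    at-zero + length (filter (P? ∘ Fin.suc) (allFin h)) ∎
    where
      open ≡-Reasoning
      at-zero : ℕ
      at-zero = if does (P? Fin.zero) then 1 else 0

flip : Word h → Fin h → Word h
flip u i = updateAt u i not

-- For either head b, Adj? (b ∷ u) (not b ∷ v) reduces to the decision used here,
-- so this one lemma counts the neighbours across the first coordinate in both cases.
count-neighbours-across : ∀ {P : Pred (Word h) ℓ} (P? : Decidable P) (u : Word h) →
  length (filter (λ v → P? v ×-dec Adj? (true ∷ u) (false ∷ v)) (allWords h)) ≡
  (if does (P? u) then 1 else 0)
count-neighbours-across P? [] with does (P? [])
... | true  = refl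
... | false = refl
count-neighbours-across P? (b ∷ u) =
  trans (length-filter-allWords (λ v → P? v ×-dec Adj? (true ∷ b ∷ u) (false ∷ v))) (split b)
  where
    none : ∀ {c} →
      length (filter (λ v → P? (c ∷ v) ×-dec (suc (suc (hamming u v)) ≟ 1)) (allWords _)) ≡ 0
    none {c} = cong length (filter-none (λ v → P? (c ∷ v) ×-dec (suc (suc (hamming u v)) ≟ 1))
                                        (All.universal (λ _ → λ { (_ , ()) }) (allWords _)))

    split : ∀ b → length (filter (λ v → P? (false ∷ v) ×-dec Adj? (true ∷ b ∷ u) (false ∷ false ∷ v)) (allWords _))
                + length (filter (λ v → P? (true ∷ v) ×-dec Adj? (true ∷ b ∷ u) (false ∷ true ∷ v)) (allWords _))
                ≡ (if does (P? (b ∷ u)) then 1 else 0)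
    split false = trans (cong₂ _+_ (count-neighbours-across (P? ∘ (false ∷_)) u) none) (+-identityʳ _)
    split true  = cong₂ _+_ none (count-neighbours-across (P? ∘ (true ∷_)) u)

count-neighbours : ∀ {P : Pred (Word h) ℓ} (P? : Decidable P) (u : Word h) →
  length (filter (λ v → P? v ×-dec Adj? u v) (allWords h)) ≡ length (filter (P? ∘ flip u) (allFin h))
count-neighbours P? [] with does (P? [])
... | true  = refl
... | false = refl
count-neighbours P? (b ∷ u) =
  trans (length-filter-allWords (λ v → P? v ×-dec Adj? (b ∷ u) v))
    (trans (split b) (sym (length-filter-allFin (P? ∘ flip (b ∷ u)))))
  where
    split : ∀ b → length (filter (λ v → P? (false ∷ v) ×-dec Adj? (b ∷ u) (false ∷ v)) (allWords _))
                + length (filter (λ v → P? (true ∷ v) ×-dec Adj? (b ∷ u) (true ∷ v)) (allWords _))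
                ≡ (if does (P? (not b ∷ u)) then 1 else 0)
                + length (filter (λ i → P? (b ∷ flip u i)) (allFin _))
    split false = trans (cong₂ _+_ (count-neighbours (P? ∘ (false ∷_)) u)
                                   (count-neighbours-across (P? ∘ (true ∷_)) u))
                        (+-comm (length (filter (λ i → P? (false ∷ flip u i)) (allFin _))) _)
    split true  = cong₂ _+_ (count-neighbours-across (P? ∘ (false ∷_)) u)
                            (count-neighbours (P? ∘ (true ∷_)) u)

full-degree⇒flip-InG : ∀ {X : List (Word h)} {u} → degree X u ≡ h → ∀ i → InG X (flip u i)
full-degree⇒flip-InG {h} {X} {u} deg i =
  All.lookup (subst (All (InG X ∘ flip u)) (filter-complete Q? all-counted) (all-filter Q? (allFin h)))
             (∈-allFin i)
  where
    Q? : Decidable (InG X ∘ flip u)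
    Q? = InG? X ∘ flip u

    all-counted : length (filter Q? (allFin h)) ≡ length (allFin h)
    all-counted = trans (sym (count-neighbours (InG? X) u)) (trans deg (sym (length-tabulate id)))

≤w-flip : (u : Word h) (i : Fin h) → lookup u i ≡ false → u ≤w flip u i
≤w-flip (false ∷ u) Fin.zero    _  = f≤t ∷ ≤w-refl
≤w-flip (true  ∷ u) Fin.zero    ()
≤w-flip (b ∷ u)     (Fin.suc i) uᵢ = b≤b ∷ ≤w-flip u i uᵢ

full-degree⇒above-with-support : ∀ {X : List (Word h)} {u} → InG X u → degree X u ≡ h →
  ∀ i → ∃ λ y → InG X y × u ≤w y × InSupport i y
full-degree⇒above-with-support {u = u} u∈G deg i with lookup u i in uᵢ
... | true  = u , u∈G , ≤w-refl , uᵢ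
... | false = flip u i , full-degree⇒flip-InG deg i , ≤w-flip u i uᵢ ,
              trans (lookup∘updateAt i u) (cong not uᵢ)

≤w-support : ∀ {x y : Word h} → x ≤w y → ∀ i → InSupport i x → InSupport i y
≤w-support (b≤b ∷ _)   Fin.zero    xᵢ = xᵢ
≤w-support (f≤t ∷ _)   Fin.zero    _  = refl
≤w-support (_ ∷ x≤y) (Fin.suc i) xᵢ = ≤w-support x≤y i xᵢ

proposition6 : (h : ℕ) (X : List (Word h)) (u : Word h) →
    InG X u → degree X u ≡ h →
    (i : Fin h) → Σ (Word h) λ x →
      (Maximal X x × InInterval X (zeroW h) x u) × InSupport i x
proposition6 h X u u∈G deg i =
  let y , y∈G , u≤y , yᵢ     = full-degree⇒above-with-support u∈G deg i
      x , x-maximal , y≤x   = InG⇒≤w-maximal y∈G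
      u≤x                   = ≤w-trans u≤y y≤x
  in  x , (x-maximal , ≤w-interval (proj₁ x-maximal) (zeroW-≤w u) u≤x) , ≤w-support y≤x i yᵢ
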